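{- For every integer $n\ge 3$ there exists a labeled tree with $n$ vertices whose chain group is the alternating group $A_n$.
   Context: A tree is a finite connected acyclic graph; a labeled tree with $n$ vertices has vertex set $[n]$. A path in a graph is a sequence of pairwise distinct vertices $v_1,\dots,v_m$ with $v_i$ adjacent to $v_{i+1}$ for all $i$; it is maximal if it is not strictly contained in another path. The chain group of a labeled tree $\mathsf{T}$ with $n$ vertices is the subgroup of $S_n$ generated by all cycles $(i_1\ \cdots\ i_m)$ such that $i_1,\dots,i_m$ is a maximal path of $\mathsf{T}$. -}

module Defs where

open import Level using (0ℓ)
open import Data.Nat using (ℕ; _≤_)
open import Data.Fin using (Fin; _≟_)
open import Data.List using (List; []; _∷_; _++_; [_]; length; head; last; reverse)
open import Data.List.Relation.Unary.Unique.Propositional using (Unique)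
open import Data.List.Relation.Unary.All using (All)
open import Data.Maybe using (Maybe; just)
open import Data.Product using (Σ; ∃; ∃-syntax; _×_; _,_)
open import Relation.Nullary using (¬_; yes; no)
open import Relation.Binary.PropositionalEquality using (_≡_; _≢_)
open import Function using (_∘_; id)

-- A simple graph on the vertex set Fin n (labels 0..n-1 stand for 1..n).
record Graph (n : ℕ) : Set₁ where
  field
    Adj     : Fin n → Fin n → Set
    sym     : ∀ {x y} → Adj x y → Adj y x
    irrefl  : ∀ {x} → ¬ Adj x x

module _ {n : ℕ} (G : Graph n) where
  open Graph G

  data Walk : List (Fin n) → Set where
    single : ∀ x → Walk [ x ]
    step   : ∀ {x y l} → Adj x y → Walk (y ∷ l) → Walk (x ∷ y ∷ l)

  IsPath : List (Fin n) → Set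
  IsPath p = Walk p × Unique p

  StrictlyContained : List (Fin n) → List (Fin n) → Set
  StrictlyContained p q = (∃[ a ] ∃[ b ] q ≡ a ++ p ++ b) × p ≢ q

  IsMaximalPath : List (Fin n) → Set
  IsMaximalPath p = IsPath p × (∀ q → IsPath q → ¬ StrictlyContained p q)

  Connected : Set
  Connected = ∀ u v → ∃[ p ] IsPath p × head p ≡ just u × last p ≡ just v

  IsCycle : List (Fin n) → Set
  IsCycle c = IsPath c × 3 ≤ length c ×
              ∃[ u ] ∃[ v ] head c ≡ just u × last c ≡ just v × Adj v u

  Acyclic : Set
  Acyclic = ∀ c → ¬ IsCycle c

  IsTree : Set
  IsTree = Connected × Acyclic

-- Permutations of Fin n are represented as functions Fin n → Fin n
-- and compared pointwise.
_≗_ : {n : ℕ} → (Fin n → Fin n) → (Fin n → Fin n) → Set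
f ≗ g = ∀ x → f x ≡ g x

-- the cycle (i₁ i₂ ⋯ iₘ): iₖ ↦ iₖ₊₁, iₘ ↦ i₁, other points fixed
-- cycleGo first b l x : image of x under the tail b ∷ l of the cycle whose first entry is first
cycleGo : {n : ℕ} → Fin n → Fin n → List (Fin n) → Fin n → Fin n
cycleGo first b []      x with x ≟ b
... | yes _ = first
... | no  _ = x
cycleGo first b (c ∷ l) x with x ≟ b
... | yes _ = c
... | no  _ = cycleGo first c l x

cycle : {n : ℕ} → List (Fin n) → Fin n → Fin n
cycle []      = id
cycle (a ∷ l) = cycleGo a a l

-- The subgroup of S_n generated by the cycles (i₁ ⋯ iₘ) with i₁..iₘ in a set S
-- of sequences: all products of such cycles and their inverses; the inverse of
-- (i₁ ⋯ iₘ) is (iₘ ⋯ i₁).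
data Words {n : ℕ} (S : List (Fin n) → Set) : (Fin n → Fin n) → Set where
  idW   : Words S id
  mulW  : ∀ {p σ} → S p → Words S σ → Words S (cycle p ∘ σ)
  mulW⁻ : ∀ {p σ} → S p → Words S σ → Words S (cycle (reverse p) ∘ σ)

GeneratedBy : {n : ℕ} → (List (Fin n) → Set) → (Fin n → Fin n) → Set
GeneratedBy S σ = ∃[ τ ] Words S τ × σ ≗ τ

InChainGroup : {n : ℕ} → Graph n → (Fin n → Fin n) → Set
InChainGroup G = GeneratedBy (IsMaximalPath G)

transposition : {n : ℕ} → Fin n → Fin n → Fin n → Fin n
transposition i j x with x ≟ i
... | yes _ = j
... | no _ with x ≟ j
...   | yes _ = i
...   | no  _ = x

data EvenProduct {n : ℕ} : (Fin n → Fin n) → Set where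
  idE   : EvenProduct id
  twoE  : ∀ {σ} i j k l → i ≢ j → k ≢ l → EvenProduct σ →
          EvenProduct (transposition i j ∘ transposition k l ∘ σ)

InAlternating : {n : ℕ} → (Fin n → Fin n) → Set
InAlternating σ = ∃[ τ ] EvenProduct τ × σ ≗ τ

module Submission where

-- The tree realising A_n is the star K_{1,n-1}: vertex 0 is the centre and
-- every other vertex is a leaf adjacent only to it.
--
-- 1. Transpositions of Fin n: basic evaluation lemmas and three identities,
--    (a c b) = (c a)(c b),  (i j) = (c i)(c j)(c i)  and  (i j) = (j i).
-- 2. The star is a tree, and its maximal paths are exactly the sequences
--    a, centre, b with a ≠ b leaves: a path in a star has at most three
--    vertices, and shorter paths can always be extended.
-- 3. Hence the chain group is generated by the 3-cycles (a c b) = (c a)(c b).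
--    Each such generator is a product of two transpositions, so the chain
--    group lies in A_n.  Conversely every transposition is a product of an
--    odd number of "star transpositions" (c a), so a product of two
--    transpositions is a product of an even number of them, i.e. of pairs
--    (c a)(c b), each of which is the identity or a generator.

open import Defs
open import Data.Nat using (ℕ; _≤_; _<_; _+_; zero; suc; s≤s; z≤n)
open import Data.Nat.Properties using (m≤m+n; m≤n+m; m<m+n; <⇒≱; module ≤-Reasoning)
open import Data.Fin using (Fin; _≟_) renaming (zero to fzero; suc to fsuc)
open import Data.Product using (Σ; _×_; _,_)
open import Data.Sum using (_⊎_; inj₁; inj₂)
open import Data.Empty using (⊥-elim)
open import Data.List using (List; []; _∷_; _++_; length; reverse)
open import Data.List.Properties using (length-++; ++-identityʳ)
open import Data.List.Relation.Unary.All using (All; []; _∷_)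
open import Data.List.Relation.Unary.All.Properties using (++⁺)
open import Data.List.Relation.Unary.AllPairs using ([]; _∷_)
open import Relation.Nullary using (¬_; yes; no; Dec)
open import Relation.Binary.PropositionalEquality
  using (_≡_; _≢_; refl; sym; trans; cong; ≢-sym; module ≡-Reasoning)
open import Function using (_∘_; id)

module _ {n : ℕ} where

  transposition-left : ∀ (i j : Fin n) → transposition i j i ≡ j
  transposition-left i j with i ≟ i
  ... | yes _  = refl
  ... | no i≢i = ⊥-elim (i≢i refl)

  transposition-right : ∀ (i j : Fin n) → transposition i j j ≡ i
  transposition-right i j with j ≟ i
  ... | yes refl = refl
  ... | no _ with j ≟ j
  ...   | yes _  = refl
  ...   | no j≢j = ⊥-elim (j≢j refl)

  transposition-fixed : ∀ {i j x : Fin n} → x ≢ i → x ≢ j → transposition i j x ≡ x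
  transposition-fixed {i} {j} {x} x≢i x≢j with x ≟ i
  ... | yes x≡i = ⊥-elim (x≢i x≡i)
  ... | no _ with x ≟ j
  ...   | yes x≡j = ⊥-elim (x≢j x≡j)
  ...   | no _    = refl

  transposition-comm : ∀ (i j x : Fin n) → transposition i j x ≡ transposition j i x
  transposition-comm i j x = by-cases x (x ≟ i) (x ≟ j)
    where
      by-cases : ∀ x → Dec (x ≡ i) → Dec (x ≡ j) → transposition i j x ≡ transposition j i x
      by-cases x (yes refl) _        = trans (transposition-left x j) (sym (transposition-right j x))
      by-cases x (no _)     (yes refl) = trans (transposition-right i x) (sym (transposition-left x i))
      by-cases x (no x≢i)   (no x≢j)   = trans (transposition-fixed x≢i x≢j) (sym (transposition-fixed x≢j x≢i))

  transposition-involutive : ∀ (i j x : Fin n) → transposition i j (transposition i j x) ≡ x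
  transposition-involutive i j x = by-cases x (x ≟ i) (x ≟ j)
    where
      by-cases : ∀ x → Dec (x ≡ i) → Dec (x ≡ j) → transposition i j (transposition i j x) ≡ x
      by-cases x (yes refl) _ =
        trans (cong (transposition x j) (transposition-left x j)) (transposition-right x j)
      by-cases x (no _) (yes refl) =
        trans (cong (transposition i x) (transposition-right i x)) (transposition-left i x)
      by-cases x (no x≢i) (no x≢j) =
        trans (cong (transposition i j) (transposition-fixed x≢i x≢j)) (transposition-fixed x≢i x≢j)

  transposition-conjugate : ∀ {c i j : Fin n} → i ≢ c → j ≢ c → i ≢ j →
    ∀ x → transposition i j x ≡ transposition c i (transposition c j (transposition c i x))
  transposition-conjugate {c} {i} {j} i≢c j≢c i≢j x = by-cases x (x ≟ c) (x ≟ i) (x ≟ j)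
   where
    open ≡-Reasoning
    by-cases : ∀ x → Dec (x ≡ c) → Dec (x ≡ i) → Dec (x ≡ j) →
      transposition i j x ≡ transposition c i (transposition c j (transposition c i x))
    by-cases x (yes refl) _ _ = begin
      transposition i j x                                  ≡⟨ transposition-fixed (≢-sym i≢c) (≢-sym j≢c) ⟩
      x                                                    ≡⟨ transposition-right x i ⟨
      transposition x i i                                  ≡⟨ cong (transposition x i) (transposition-fixed i≢c i≢j) ⟨
      transposition x i (transposition x j i)              ≡⟨ cong (transposition x i ∘ transposition x j) (transposition-left x i) ⟨
      transposition x i (transposition x j (transposition x i x)) ∎
    by-cases x (no _) (yes refl) _ = begin
      transposition x j x                                  ≡⟨ transposition-left x j ⟩
      j                                                    ≡⟨ transposition-fixed j≢c (≢-sym i≢j) ⟨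
      transposition c x j                                  ≡⟨ cong (transposition c x) (transposition-left c j) ⟨
      transposition c x (transposition c j c)              ≡⟨ cong (transposition c x ∘ transposition c j) (transposition-right c x) ⟨
      transposition c x (transposition c j (transposition c x x)) ∎
    by-cases x (no x≢c) (no _) (yes refl) = begin
      transposition i x x                                  ≡⟨ transposition-right i x ⟩
      i                                                    ≡⟨ transposition-left c i ⟨
      transposition c i c                                  ≡⟨ cong (transposition c i) (transposition-right c x) ⟨
      transposition c i (transposition c x x)              ≡⟨ cong (transposition c i ∘ transposition c x) (transposition-fixed x≢c (≢-sym i≢j)) ⟨
      transposition c i (transposition c x (transposition c i x)) ∎
    by-cases x (no x≢c) (no x≢i) (no x≢j) = begin
      transposition i j x                                  ≡⟨ transposition-fixed x≢i x≢j ⟩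
      x                                                    ≡⟨ transposition-fixed x≢c x≢i ⟨
      transposition c i x                                  ≡⟨ cong (transposition c i) (transposition-fixed x≢c x≢j) ⟨
      transposition c i (transposition c j x)              ≡⟨ cong (transposition c i ∘ transposition c j) (transposition-fixed x≢c x≢i) ⟨
      transposition c i (transposition c j (transposition c i x)) ∎

  private
    3-cycle : Fin n → Fin n → Fin n → Fin n → Fin n
    3-cycle a c b = cycle (a ∷ c ∷ b ∷ [])

  3-cycle-first : ∀ (a c b : Fin n) → 3-cycle a c b a ≡ c
  3-cycle-first a c b with a ≟ a
  ... | yes _  = refl
  ... | no a≢a = ⊥-elim (a≢a refl)

  3-cycle-second : ∀ {a c : Fin n} b → c ≢ a → 3-cycle a c b c ≡ b
  3-cycle-second {a} {c} b c≢a with c ≟ a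
  ... | yes c≡a = ⊥-elim (c≢a c≡a)
  ... | no _ with c ≟ c
  ...   | yes _  = refl
  ...   | no c≢c = ⊥-elim (c≢c refl)

  3-cycle-third : ∀ {a c b : Fin n} → b ≢ a → b ≢ c → 3-cycle a c b b ≡ a
  3-cycle-third {a} {c} {b} b≢a b≢c with b ≟ a
  ... | yes b≡a = ⊥-elim (b≢a b≡a)
  ... | no _ with b ≟ c
  ...   | yes b≡c = ⊥-elim (b≢c b≡c)
  ...   | no _ with b ≟ b
  ...     | yes _  = refl
  ...     | no b≢b = ⊥-elim (b≢b refl)

  3-cycle-fixed : ∀ {a c b x : Fin n} → x ≢ a → x ≢ c → x ≢ b → 3-cycle a c b x ≡ x
  3-cycle-fixed {a} {c} {b} {x} x≢a x≢c x≢b with x ≟ a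
  ... | yes x≡a = ⊥-elim (x≢a x≡a)
  ... | no _ with x ≟ c
  ...   | yes x≡c = ⊥-elim (x≢c x≡c)
  ...   | no _ with x ≟ b
  ...     | yes x≡b = ⊥-elim (x≢b x≡b)
  ...     | no _    = refl

  3-cycle-as-transpositions : ∀ {a c b : Fin n} → a ≢ c → b ≢ c → a ≢ b →
    ∀ x → cycle (a ∷ c ∷ b ∷ []) x ≡ transposition c a (transposition c b x)
  3-cycle-as-transpositions {a} {c} {b} a≢c b≢c a≢b x = by-cases x (x ≟ c) (x ≟ a) (x ≟ b)
   where
    by-cases : ∀ x → Dec (x ≡ c) → Dec (x ≡ a) → Dec (x ≡ b) →
      cycle (a ∷ c ∷ b ∷ []) x ≡ transposition c a (transposition c b x)
    by-cases x (yes refl) _ _ = trans (3-cycle-second b (≢-sym a≢c))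
      (sym (trans (cong (transposition x a) (transposition-left x b)) (transposition-fixed b≢c (≢-sym a≢b))))
    by-cases x (no _) (yes refl) _ = trans (3-cycle-first x c b)
      (sym (trans (cong (transposition c x) (transposition-fixed a≢c a≢b)) (transposition-right c x)))
    by-cases x (no _) (no _) (yes refl) = trans (3-cycle-third (≢-sym a≢b) b≢c)
      (sym (trans (cong (transposition c a) (transposition-right c x)) (transposition-left c a)))
    by-cases x (no x≢c) (no x≢a) (no x≢b) = trans (3-cycle-fixed x≢a x≢c x≢b)
      (sym (trans (cong (transposition c a) (transposition-fixed x≢c x≢b)) (transposition-fixed x≢c x≢a)))

-- Parity of the length of a list.  Writing each of two transpositions as an
-- odd product of star transpositions gives an even product, which is then
-- consumed two factors at a time.

data Even {A : Set} : List A → Set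
data Odd {A : Set} : List A → Set

data Even where
  []  : Even []
  _∷_ : ∀ x {xs} → Odd xs → Even (x ∷ xs)

data Odd where
  _∷_ : ∀ x {xs} → Even xs → Odd (x ∷ xs)

even++odd : ∀ {A : Set} {xs ys : List A} → Even xs → Odd ys → Odd (xs ++ ys)
odd++odd  : ∀ {A : Set} {xs ys : List A} → Odd xs → Odd ys → Even (xs ++ ys)

even++odd []       o = o
even++odd (x ∷ o′) o = x ∷ odd++odd o′ o
odd++odd (x ∷ e) o = x ∷ even++odd e o

-- In any graph, a sequence strictly containing p is strictly longer; this is
-- how maximality of the paths a, centre, b follows from the length bound.

strictlyContained-longer : ∀ {n} (G : Graph n) {p q : List (Fin n)} →
  StrictlyContained G p q → length p < length q
strictlyContained-longer G {p} ((a , b , refl) , p≢q) = longer a b p≢q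
  where
    open ≤-Reasoning
    longer : ∀ a b → p ≢ a ++ p ++ b → length p < length (a ++ p ++ b)
    longer [] [] p≢p = ⊥-elim (p≢p (sym (++-identityʳ p)))
    longer [] (d ∷ b) _ = begin-strict
      length p                     <⟨ m<m+n (length p) (s≤s z≤n) ⟩
      length p + length (d ∷ b)    ≡⟨ length-++ p ⟨
      length (p ++ d ∷ b)          ∎
    longer (c ∷ a) b _ = s≤s (begin
      length p                     ≤⟨ m≤m+n (length p) (length b) ⟩
      length p + length b          ≡⟨ length-++ p ⟨
      length (p ++ b)              ≤⟨ m≤n+m (length (p ++ b)) (length a) ⟩
      length a + length (p ++ b)   ≡⟨ length-++ a ⟨
      length (a ++ p ++ b)         ∎)

module Star (k : ℕ) where

  N : ℕ
  N = suc (suc (suc k))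

  V : Set
  V = Fin N

  centre : V
  centre = fzero

  Leaf : V → Set
  Leaf x = x ≢ centre

  StarAdj : V → V → Set
  StarAdj x y = (x ≡ centre × Leaf y) ⊎ (Leaf x × y ≡ centre)

  star : Graph N
  star = record { Adj = StarAdj ; sym = swap ; irrefl = irrefl }
    where
      swap : ∀ {x y} → StarAdj x y → StarAdj y x
      swap (inj₁ (x≡c , y≢c)) = inj₂ (y≢c , x≡c)
      swap (inj₂ (x≢c , y≡c)) = inj₁ (y≡c , x≢c)
      irrefl : ∀ {x} → ¬ StarAdj x x
      irrefl (inj₁ (x≡c , x≢c)) = x≢c x≡c
      irrefl (inj₂ (x≢c , x≡c)) = x≢c x≡c

  anotherLeaf : (y : V) → Σ V λ z → Leaf z × z ≢ y
  anotherLeaf y with y ≟ fsuc fzero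
  ... | yes refl = fsuc (fsuc fzero) , (λ ()) , (λ ())
  ... | no y≢1   = fsuc fzero , (λ ()) , ≢-sym y≢1

  -- The middle vertex of a two-edge walk between distinct ends is the centre;
  -- consequently a path has at most three vertices.
  middle-is-centre : ∀ {x y z} → StarAdj x y → StarAdj y z → x ≢ z → y ≡ centre
  middle-is-centre (inj₂ (_ , y≡c)) _ _ = y≡c
  middle-is-centre (inj₁ (refl , _)) (inj₂ (_ , refl)) x≢z = ⊥-elim (x≢z refl)
  middle-is-centre (inj₁ (_ , y≢c)) (inj₁ (y≡c , _)) _ = ⊥-elim (y≢c y≡c)

  -- In x y z w both y and z would be the centre, yet they are adjacent.
  no-long-path : ∀ {x y z w l} → ¬ IsPath star (x ∷ y ∷ z ∷ w ∷ l)
  no-long-path (step xy (step yz (step zw _)) , (_ ∷ x≢z ∷ _) ∷ (_ ∷ y≢w ∷ _) ∷ _)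
    with middle-is-centre xy yz x≢z | middle-is-centre yz zw y≢w
  ... | refl | refl = Graph.irrefl star yz

  path-length≤3 : ∀ p → IsPath star p → length p ≤ 3
  path-length≤3 []                  _ = z≤n
  path-length≤3 (_ ∷ [])            _ = s≤s z≤n
  path-length≤3 (_ ∷ _ ∷ [])        _ = s≤s (s≤s z≤n)
  path-length≤3 (_ ∷ _ ∷ _ ∷ [])    _ = s≤s (s≤s (s≤s z≤n))
  path-length≤3 (_ ∷ _ ∷ _ ∷ _ ∷ _) p = ⊥-elim (no-long-path p)

  three-path-shape : ∀ {x y z} → IsPath star (x ∷ y ∷ z ∷ []) →
    Leaf x × y ≡ centre × Leaf z × x ≢ z
  three-path-shape (step xy (step yz _) , (_ ∷ x≢z ∷ []) ∷ _)
    with middle-is-centre xy yz x≢z | xy | yz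
  ... | refl | inj₂ (x≢c , _) | inj₁ (_ , z≢c) = x≢c , refl , z≢c , x≢z
  ... | refl | inj₁ (_ , c≢c) | _              = ⊥-elim (c≢c refl)
  ... | refl | _              | inj₂ (c≢c , _) = ⊥-elim (c≢c refl)

  leafPath : ∀ {a b} → Leaf a → Leaf b → a ≢ b → IsPath star (a ∷ centre ∷ b ∷ [])
  leafPath a≢c b≢c a≢b =
    step (inj₂ (a≢c , refl)) (step (inj₁ (refl , b≢c)) (single _)) ,
    (a≢c ∷ a≢b ∷ []) ∷ (≢-sym b≢c ∷ []) ∷ [] ∷ []

  edgePath : ∀ {x y} → StarAdj x y → x ≢ y → IsPath star (x ∷ y ∷ [])
  edgePath xy x≢y = step xy (single _) , (x≢y ∷ []) ∷ [] ∷ []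

  star-is-tree : IsTree star
  star-is-tree = connected , acyclic
    where
      connected : Connected star
      connected u v with u ≟ v | u ≟ centre | v ≟ centre
      ... | yes refl | _ | _ = u ∷ [] , (single u , [] ∷ []) , refl , refl
      ... | no u≢v | yes refl | _ = u ∷ v ∷ [] , edgePath (inj₁ (refl , ≢-sym u≢v)) u≢v , refl , refl
      ... | no u≢v | no u≢c | yes refl = u ∷ v ∷ [] , edgePath (inj₂ (u≢c , refl)) u≢v , refl , refl
      ... | no u≢v | no u≢c | no v≢c = u ∷ centre ∷ v ∷ [] , leafPath u≢c v≢c u≢v , refl , refl

      -- A cycle would be a path of length 3 closing up between two leaves.
      acyclic : Acyclic star
      acyclic (_ ∷ _ ∷ _ ∷ []) (p , _ , _ , _ , refl , refl , closing) with three-path-shape p | closing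
      ... | x≢c , _ , _ , _ | inj₂ (_ , x≡c) = x≢c x≡c
      ... | _ , _ , z≢c , _ | inj₁ (z≡c , _) = z≢c z≡c
      acyclic (_ ∷ _ ∷ _ ∷ _ ∷ _) (p , _) = no-long-path p
      acyclic []           (_ , () , _)
      acyclic (_ ∷ [])     (_ , s≤s () , _)
      acyclic (_ ∷ _ ∷ []) (_ , s≤s (s≤s ()) , _)

  LeafPair : List V → Set
  LeafPair p = Σ V λ a → Σ V λ b → Leaf a × Leaf b × a ≢ b × p ≡ a ∷ centre ∷ b ∷ []

  leaf-path-maximal : ∀ {a b} → Leaf a → Leaf b → a ≢ b → IsMaximalPath star (a ∷ centre ∷ b ∷ [])
  leaf-path-maximal a≢c b≢c a≢b = leafPath a≢c b≢c a≢b , λ q q-path contained →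
    <⇒≱ (strictlyContained-longer star contained) (path-length≤3 q q-path)

  -- Paths with fewer than three vertices extend, so are not maximal.
  maximal-path-long : ∀ {p} → IsMaximalPath star p → 3 ≤ length p
  maximal-path-long {[]} ((() , _) , _)
  maximal-path-long {x ∷ []} (_ , maximal) with x ≟ centre
  ... | yes refl = ⊥-elim (maximal (x ∷ fsuc fzero ∷ []) (edgePath (inj₁ (refl , λ ())) λ ())
                     (([] , fsuc fzero ∷ [] , refl) , λ ()))
  ... | no x≢c   = ⊥-elim (maximal (x ∷ centre ∷ []) (edgePath (inj₂ (x≢c , refl)) x≢c)
                     (([] , centre ∷ [] , refl) , λ ()))
  maximal-path-long {x ∷ y ∷ []} ((step (inj₁ (refl , y≢c)) _ , _) , maximal) with anotherLeaf y
  ... | z , z≢c , z≢y = ⊥-elim (maximal (z ∷ centre ∷ y ∷ []) (leafPath z≢c y≢c z≢y)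
                          ((z ∷ [] , [] , refl) , λ ()))
  maximal-path-long {x ∷ y ∷ []} ((step (inj₂ (x≢c , refl)) _ , _) , maximal) with anotherLeaf x
  ... | z , z≢c , z≢x = ⊥-elim (maximal (x ∷ centre ∷ z ∷ []) (leafPath x≢c z≢c (≢-sym z≢x))
                          (([] , z ∷ [] , refl) , λ ()))
  maximal-path-long {_ ∷ _ ∷ _ ∷ _} _ = s≤s (s≤s (s≤s z≤n))

  maximal-path-shape : ∀ {p} → IsMaximalPath star p → LeafPair p
  maximal-path-shape {x ∷ y ∷ z ∷ []} (p , _) with three-path-shape p
  ... | x≢c , refl , z≢c , x≢z = x , z , x≢c , z≢c , x≢z , refl
  maximal-path-shape {_ ∷ _ ∷ _ ∷ _ ∷ _} (p , _) = ⊥-elim (no-long-path p)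
  maximal-path-shape {[]}         m with maximal-path-long m
  ... | ()
  maximal-path-shape {_ ∷ []}     m with maximal-path-long m
  ... | s≤s ()
  maximal-path-shape {_ ∷ _ ∷ []} m with maximal-path-long m
  ... | s≤s (s≤s ())

  starT : V → V → V
  starT = transposition centre

  starProduct : List V → V → V
  starProduct []       = id
  starProduct (a ∷ ws) = starT a ∘ starProduct ws

  starProduct-++ : ∀ ws vs x → starProduct (ws ++ vs) x ≡ starProduct ws (starProduct vs x)
  starProduct-++ []       vs x = refl
  starProduct-++ (a ∷ ws) vs x = cong (starT a) (starProduct-++ ws vs x)

  generator-as-star-pair : ∀ {p} → IsMaximalPath star p →
    Σ V λ a → Σ V λ b → Leaf a × Leaf b ×
      (cycle p ≗ (starT a ∘ starT b)) × (cycle (reverse p) ≗ (starT b ∘ starT a))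
  generator-as-star-pair m with maximal-path-shape m
  ... | a , b , a≢c , b≢c , a≢b , refl =
    a , b , a≢c , b≢c , 3-cycle-as-transpositions a≢c b≢c a≢b ,
    3-cycle-as-transpositions b≢c a≢c (≢-sym a≢b)

  transposition-star-odd : ∀ {i j} → i ≢ j →
    Σ (List V) λ ws → Odd ws × All Leaf ws × (transposition i j ≗ starProduct ws)
  transposition-star-odd {i} {j} i≢j with i ≟ centre | j ≟ centre
  ... | yes refl | _        = j ∷ [] , j ∷ [] , ≢-sym i≢j ∷ [] , λ _ → refl
  ... | no i≢c   | yes refl = i ∷ [] , i ∷ [] , i≢c ∷ [] , transposition-comm i j
  ... | no i≢c   | no j≢c   = i ∷ j ∷ i ∷ [] , i ∷ j ∷ i ∷ [] , i≢c ∷ j≢c ∷ i≢c ∷ [] ,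
                              transposition-conjugate i≢c j≢c i≢j

  Chain : (V → V) → Set
  Chain = InChainGroup star

  chain-resp : ∀ {f g} → f ≗ g → Chain g → Chain f
  chain-resp f≗g (τ , w , g≗τ) = τ , w , λ x → trans (f≗g x) (g≗τ x)

  -- (c a)(c b) lies in the chain group: it is the identity if a = b and the
  -- generator (a c b) otherwise.
  chain-star-pair : ∀ {a b σ} → Leaf a → Leaf b → Chain σ → Chain (starT a ∘ starT b ∘ σ)
  chain-star-pair {a} {b} {σ} a≢c b≢c σ∈ with a ≟ b
  ... | yes refl = chain-resp (λ x → transposition-involutive centre a (σ x)) σ∈
  ... | no a≢b with σ∈
  ...   | τ , w , σ≗τ = cycle (a ∷ centre ∷ b ∷ []) ∘ τ , mulW (leaf-path-maximal a≢c b≢c a≢b) w ,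
          λ x → trans (cong (starT a ∘ starT b) (σ≗τ x)) (sym (3-cycle-as-transpositions a≢c b≢c a≢b (τ x)))

  chain-even-star : ∀ {ws σ} → Even ws → All Leaf ws → Chain σ → Chain (starProduct ws ∘ σ)
  chain-even-star []               _                    σ∈ = σ∈
  chain-even-star (a ∷ (b ∷ even)) (a≢c ∷ b≢c ∷ leaves) σ∈ =
    chain-star-pair a≢c b≢c (chain-even-star even leaves σ∈)

  -- A_n ⊆ chain group: a product of two transpositions is an even star product.
  alternating⊆chain : ∀ {σ} → EvenProduct σ → Chain σ
  alternating⊆chain idE = id , idW , λ _ → refl
  alternating⊆chain (twoE {σ} i j k l i≢j k≢l ev)
    with transposition-star-odd i≢j | transposition-star-odd k≢l
  ... | ws , ws-odd , ws-leaves , ij≗ws | vs , vs-odd , vs-leaves , kl≗vs =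
    chain-resp product-eq
      (chain-even-star (odd++odd ws-odd vs-odd) (++⁺ ws-leaves vs-leaves) (alternating⊆chain ev))
    where
      product-eq : (transposition i j ∘ transposition k l ∘ σ) ≗ (starProduct (ws ++ vs) ∘ σ)
      product-eq x = begin
        transposition i j (transposition k l (σ x))   ≡⟨ ij≗ws _ ⟩
        starProduct ws (transposition k l (σ x))      ≡⟨ cong (starProduct ws) (kl≗vs (σ x)) ⟩
        starProduct ws (starProduct vs (σ x))         ≡⟨ starProduct-++ ws vs (σ x) ⟨
        starProduct (ws ++ vs) (σ x)                  ∎
        where open ≡-Reasoning

  alternating-star-pair : ∀ {a b f τ} → Leaf a → Leaf b → f ≗ (starT a ∘ starT b) →
    InAlternating τ → InAlternating (f ∘ τ)
  alternating-star-pair {a} {b} a≢c b≢c f≗ab (τ′ , ev , τ≗τ′) =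
    starT a ∘ starT b ∘ τ′ , twoE centre a centre b (≢-sym a≢c) (≢-sym b≢c) ev ,
    λ x → trans (f≗ab _) (cong (starT a ∘ starT b) (τ≗τ′ x))

  -- Chain group ⊆ A_n: every generator and inverse generator is (c a)(c b).
  words⊆alternating : ∀ {τ} → Words (IsMaximalPath star) τ → InAlternating τ
  words⊆alternating idW = id , idE , λ _ → refl
  words⊆alternating (mulW m w) with generator-as-star-pair m
  ... | a , b , a≢c , b≢c , p≗ab , _ = alternating-star-pair a≢c b≢c p≗ab (words⊆alternating w)
  words⊆alternating (mulW⁻ m w) with generator-as-star-pair m
  ... | a , b , a≢c , b≢c , _ , p⁻¹≗ba = alternating-star-pair b≢c a≢c p⁻¹≗ba (words⊆alternating w)

  chain-group-is-alternating : (σ : V → V) →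
    (InChainGroup star σ → InAlternating σ) × (InAlternating σ → InChainGroup star σ)
  chain-group-is-alternating σ = chain⊆alternating , alternating⊆chain′
    where
      chain⊆alternating : InChainGroup star σ → InAlternating σ
      chain⊆alternating (τ , w , σ≗τ) with words⊆alternating w
      ... | τ′ , ev , τ≗τ′ = τ′ , ev , λ x → trans (σ≗τ x) (τ≗τ′ x)
      alternating⊆chain′ : InAlternating σ → InChainGroup star σ
      alternating⊆chain′ (τ , ev , σ≗τ) = chain-resp σ≗τ (alternating⊆chain ev)

mainTheorem6 : (n : ℕ) → 3 ≤ n →
    Σ (Graph n) λ T → IsTree T ×
      ((σ : Fin n → Fin n) → (InChainGroup T σ → InAlternating σ) × (InAlternating σ → InChainGroup T σ))
mainTheorem6 (suc (suc (suc k))) _ = star , star-is-tree , chain-group-is-alternating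
  where open Star k
mainTheorem6 (suc zero)       (s≤s ())
mainTheorem6 (suc (suc zero)) (s≤s (s≤s ()))
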